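{- For every integer $n\ge 2$, $$L_{n,3}=\frac{1}{16}(n-2)\left(9n^5-9n^4-81n^3+81n^2+160n-192\right),$$ equivalently $L_{n,3}=24-22\binom{n}{1}+20\binom{n}{2}+378\binom{n}{4}+810\binom{n}{5}+405\binom{n}{6}$.
   Context: Let $n\ge 1$ be an integer. Subdivide an equilateral triangle of side length $n$ into $n^2$ equilateral unit triangles by dividing each side into $n$ equal segments and drawing through the division points all lines parallel to the three sides. An edge of this subdivision (a side of a unit triangle) is called inner if it does not lie on the boundary of the big triangle; there are $3n(n-1)/2$ inner edges. Removing an inner edge merges the two unit triangles sharing it into a lozenge. For $l\ge 0$, $L_{n,l}$ denotes the number of sets of $l$ inner edges such that no two edges of the set are sides of the same unit triangle (equivalently, the number of ways to place $l$ non-overlapping lozenges, each the union of two adjacent unit triangles, in the big triangle, the remaining $n^2-2l$ unit triangles being left uncovered). Configurations related by symmetries of the big triangle are counted as distinct. -}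

module Defs where

open import Data.Bool using (Bool; true; false)
open import Data.Nat using (ℕ; zero; suc; _∸_)
import Data.Nat as ℕ
import Data.Bool as 𝔹
open import Data.Fin using (Fin; toℕ)
open import Data.List using (List; []; _∷_; map; concatMap; upTo; allFin; filter; length)
open import Data.Product using (_×_; _,_)
open import Data.Product.Properties using (≡-dec)
open import Data.List.Relation.Unary.AllPairs using (AllPairs; allPairs?)
open import Relation.Binary.PropositionalEquality using (_≡_)
open import Relation.Nullary using (¬_; Dec)
open import Relation.Nullary.Decidable using (¬?; _×-dec_)

-- Coordinates of the subdivision of the triangle of side n (rows counted
-- from the top vertex, row i = 0 .. n-1):
--   upward   unit triangle  (true  , i , j) with 0 ≤ j ≤ i      (i+1 of them)
--   downward unit triangle  (false , i , j) with 1 ≤ i, 0 ≤ j < i (i of them)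
-- Total: Σ (2i+1) = n² unit triangles.
Tri : Set
Tri = Bool × ℕ × ℕ

upT : ℕ → ℕ → Tri
upT i j = true , i , j

downT : ℕ → ℕ → Tri
downT i j = false , i , j

-- Every inner edge is shared by exactly one downward and one upward unit
-- triangle, and every side of a downward triangle is inner.  So inner edges
-- are in bijection with pairs (downward triangle (i , j), side k ∈ Fin 3):
--   k = 0 : left  side, shared with upT i j
--   k = 1 : right side, shared with upT i (j+1)
--   k = 2 : top   side, shared with upT (i-1) j
-- There are 3 · n(n-1)/2 of them.
Edge : Set
Edge = ℕ × ℕ × Fin 3

innerEdges : ℕ → List Edge
innerEdges n =
  concatMap (λ i → concatMap (λ j → map (λ k → (suc i , j , k)) (allFin 3))
                              (upTo (suc i)))
            (upTo (n ∸ 1))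

upSide : Edge → Tri
upSide (i , j , k) with toℕ k
... | 0 = upT i j
... | 1 = upT i (suc j)
... | _ = upT (i ∸ 1) j

downSide : Edge → Tri
downSide (i , j , _) = downT i j

_≟T_ : (s t : Tri) → Dec (s ≡ t)
_≟T_ = ≡-dec 𝔹._≟_ (≡-dec ℕ._≟_ ℕ._≟_)

-- two edges are compatible iff they are not sides of a common unit triangle
-- (for distinct edges, two downward sides coincide, or two upward sides
-- coincide; a down side never equals an up side)
Compatible : Edge → Edge → Set
Compatible e f = ¬ (downSide e ≡ downSide f) × ¬ (upSide e ≡ upSide f)

compatible? : (e f : Edge) → Dec (Compatible e f)
compatible? e f = ¬? (downSide e ≟T downSide f) ×-dec ¬? (upSide e ≟T upSide f)

-- all sublists of length l of a list (l-element subsets of its entries,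
-- each exactly once when the list has no repetitions)
sublists : {A : Set} → ℕ → List A → List (List A)
sublists zero    _        = [] ∷ []
sublists (suc l) []       = []
sublists (suc l) (x ∷ xs) = map (x ∷_) (sublists l xs) Data.List.++ sublists (suc l) xs

L : ℕ → ℕ → ℕ
L n l = length (filter (allPairs? compatible?) (sublists l (innerEdges n)))

-- Write c(x,y) ∈ {0,1} for the compatibility of two inner edges, so that 6 L n 3 is the
-- sum of c(x,y) c(x,z) c(y,z) over ordered triples of inner edges.  Every inner edge is a
-- side of exactly one downward triangle D and one upward triangle U, and
-- c(x,y) = (1 − [D x = D y]) (1 − [U x = U y]).  As equality of triangles is transitive, the
-- triple product collapses to
--   c(x,y) (1 − [D x = D z] − [D y = D z]) (1 − [U x = U z] − [U y = U z]).
-- Summing out z and then y (regrouping the mixed terms [D x = D z] [U y = U z] around z)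
-- leaves a sum over single edges x of a quadratic Φ in the number E of inner edges, the
-- down-degree of x (always 3) and its up-degree, the number of inner sides of U x.
-- Finally 3, 6(n − 2) and 3·C(n − 2, 2) inner edges have up-degree 1, 2 and 3, which
-- turns the sum into a polynomial in n.

module Submission where

open import Defs
open import Data.Bool using (Bool; true; false; _∧_)
open import Data.Fin using () renaming (zero to 0F; suc to sucF)
open import Data.Integer using (ℤ; +_; _+_; _-_; _*_; _^_)
import Data.Integer.Properties as ℤ
open import Data.Integer.Tactic.RingSolver using (solve-∀)
open import Data.List using (List; []; _∷_; _++_; map; concat; filter; length; applyUpTo; upTo; allFin)
open import Data.List.Properties using (length-++; filter-++; map-++)
open import Data.List.Relation.Unary.All using (All; []; _∷_)
import Data.List.Relation.Unary.All.Properties as All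
open import Data.List.Relation.Unary.AllPairs using (allPairs?)
open import Data.Nat using (ℕ; zero; suc; _∸_; _<_; _≤_; _≥_; s≤s)
import Data.Nat.Properties as ℕ
open import Data.Product using (_,_; proj₁; proj₂)
open import Function using (_∘_)
open import Relation.Binary.Definitions using (tri<; tri≈; tri>)
import Relation.Binary.Definitions as Binary
open import Relation.Binary.PropositionalEquality
open import Relation.Nullary using (Dec; does; yes; no; ¬_)
open import Relation.Nullary.Decidable using (dec-true; dec-false; _×-dec_)
import Relation.Unary as Unary

private variable
  A B P Q : Set

𝟙 : Bool → ℤ
𝟙 true  = + 1
𝟙 false = + 0

𝟙[_] : Dec P → ℤ
𝟙[ p? ] = 𝟙 (does p?)

𝟙-∧ : ∀ a b → 𝟙 (a ∧ b) ≡ 𝟙 a * 𝟙 b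
𝟙-∧ true  true  = refl
𝟙-∧ true  false = refl
𝟙-∧ false b     = refl

𝟙-idem : (p? : Dec P) → 𝟙[ p? ] * 𝟙[ p? ] ≡ 𝟙[ p? ]
𝟙-idem p? with does p?
... | true  = refl
... | false = refl

𝟙-yes : (p? : Dec P) → P → 𝟙[ p? ] ≡ + 1
𝟙-yes p? p = cong 𝟙 (dec-true p? p)

𝟙-no : (p? : Dec P) → ¬ P → 𝟙[ p? ] ≡ + 0
𝟙-no p? ¬p = cong 𝟙 (dec-false p? ¬p)

𝟙-cong : (P → Q) → (Q → P) → (p? : Dec P) (q? : Dec Q) → 𝟙[ p? ] ≡ 𝟙[ q? ]
𝟙-cong f g p? q? with p?
... | yes p = sym (𝟙-yes q? (f p))
... | no ¬p = sym (𝟙-no q? (¬p ∘ g))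

𝟙-≡-subst : ∀ {a b : A} (eq? : Dec (a ≡ b)) (ψ : A → ℤ) → 𝟙[ eq? ] * ψ b ≡ 𝟙[ eq? ] * ψ a
𝟙-≡-subst eq? ψ with eq?
... | yes refl = refl
... | no  _    = refl

𝟙-<-suc : ∀ a m → 𝟙[ a ℕ.<? suc m ] ≡ 𝟙[ a ℕ.<? m ] + 𝟙[ a ℕ.≟ m ]
𝟙-<-suc a m with ℕ.<-cmp a m
... | tri< a<m a≢m _ = begin
    𝟙[ a ℕ.<? suc m ]                  ≡⟨ 𝟙-yes (a ℕ.<? suc m) (ℕ.m<n⇒m<1+n a<m) ⟩
    + 1                                ≡˘⟨ cong₂ _+_ (𝟙-yes (a ℕ.<? m) a<m) (𝟙-no (a ℕ.≟ m) a≢m) ⟩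
    𝟙[ a ℕ.<? m ] + 𝟙[ a ℕ.≟ m ]        ∎
  where open ≡-Reasoning
... | tri≈ a≮m a≡m _ = begin
    𝟙[ a ℕ.<? suc m ]                  ≡⟨ 𝟙-yes (a ℕ.<? suc m) (s≤s (ℕ.≤-reflexive a≡m)) ⟩
    + 1                                ≡˘⟨ cong₂ _+_ (𝟙-no (a ℕ.<? m) a≮m) (𝟙-yes (a ℕ.≟ m) a≡m) ⟩
    𝟙[ a ℕ.<? m ] + 𝟙[ a ℕ.≟ m ]        ∎
  where open ≡-Reasoning
... | tri> a≮m a≢m m<a = begin
    𝟙[ a ℕ.<? suc m ]                  ≡⟨ 𝟙-no (a ℕ.<? suc m) (ℕ.<⇒≱ m<a ∘ ℕ.≤-pred) ⟩
    + 0                                ≡˘⟨ cong₂ _+_ (𝟙-no (a ℕ.<? m) a≮m) (𝟙-no (a ℕ.≟ m) a≢m) ⟩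
    𝟙[ a ℕ.<? m ] + 𝟙[ a ℕ.≟ m ]        ∎
  where open ≡-Reasoning

-- Finite sums

Σ : List A → (A → ℤ) → ℤ
Σ []       f = + 0
Σ (x ∷ xs) f = f x + Σ xs f

Σ-cong : ∀ (xs : List A) {f g : A → ℤ} → (∀ x → f x ≡ g x) → Σ xs f ≡ Σ xs g
Σ-cong []       eq = refl
Σ-cong (x ∷ xs) eq = cong₂ _+_ (eq x) (Σ-cong xs eq)

Σ-cong-All : ∀ {R : A → Set} {xs f g} → All R xs → (∀ {x} → R x → f x ≡ g x) → Σ xs f ≡ Σ xs g
Σ-cong-All []       eq = refl
Σ-cong-All (r ∷ rs) eq = cong₂ _+_ (eq r) (Σ-cong-All rs eq)

Σ-+ : ∀ (xs : List A) (f g : A → ℤ) → Σ xs (λ x → f x + g x) ≡ Σ xs f + Σ xs g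
Σ-+ []       f g = refl
Σ-+ (x ∷ xs) f g rewrite Σ-+ xs f g = shuffle (f x) (g x) (Σ xs f) (Σ xs g)
  where shuffle : ∀ a b c d → a + b + (c + d) ≡ a + c + (b + d)
        shuffle = solve-∀

Σ-- : ∀ (xs : List A) (f g : A → ℤ) → Σ xs (λ x → f x - g x) ≡ Σ xs f - Σ xs g
Σ-- []       f g = refl
Σ-- (x ∷ xs) f g rewrite Σ-- xs f g = shuffle (f x) (g x) (Σ xs f) (Σ xs g)
  where shuffle : ∀ a b c d → a - b + (c - d) ≡ a + c - (b + d)
        shuffle = solve-∀

Σ-*ˡ : ∀ (xs : List A) k (f : A → ℤ) → Σ xs (λ x → k * f x) ≡ k * Σ xs f
Σ-*ˡ []       k f = sym (ℤ.*-zeroʳ k)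
Σ-*ˡ (x ∷ xs) k f rewrite Σ-*ˡ xs k f = sym (ℤ.*-distribˡ-+ k (f x) (Σ xs f))

Σ-*ʳ : ∀ (xs : List A) k (f : A → ℤ) → Σ xs (λ x → f x * k) ≡ Σ xs f * k
Σ-*ʳ []       k f = refl
Σ-*ʳ (x ∷ xs) k f rewrite Σ-*ʳ xs k f = sym (ℤ.*-distribʳ-+ k (f x) (Σ xs f))

Σ-zero : ∀ (xs : List A) → Σ xs (λ _ → + 0) ≡ + 0
Σ-zero []       = refl
Σ-zero (x ∷ xs) = trans (ℤ.+-identityˡ _) (Σ-zero xs)

Σ-one : ∀ (xs : List A) → Σ xs (λ _ → + 1) ≡ + length xs
Σ-one []       = refl
Σ-one (x ∷ xs) = cong (λ s → + 1 + s) (Σ-one xs)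

Σ-swap : ∀ (xs : List A) (ys : List B) (f : A → B → ℤ) →
         Σ xs (λ x → Σ ys (f x)) ≡ Σ ys (λ y → Σ xs (λ x → f x y))
Σ-swap []       ys f = sym (Σ-zero ys)
Σ-swap (x ∷ xs) ys f = trans (cong (_+_ (Σ ys (f x))) (Σ-swap xs ys f))
                             (sym (Σ-+ ys (f x) (λ y → Σ xs (λ x → f x y))))

Σ-product : ∀ (xs : List A) (ys : List B) (f : A → ℤ) (g : B → ℤ) →
            Σ xs (λ x → Σ ys (λ y → f x * g y)) ≡ Σ xs f * Σ ys g
Σ-product xs ys f g = trans (Σ-cong xs (λ x → Σ-*ˡ ys (f x) g)) (Σ-*ʳ xs (Σ ys g) f)

Σ-++ : ∀ (xs ys : List A) f → Σ (xs ++ ys) f ≡ Σ xs f + Σ ys f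
Σ-++ []       ys f = sym (ℤ.+-identityˡ _)
Σ-++ (x ∷ xs) ys f rewrite Σ-++ xs ys f = sym (ℤ.+-assoc (f x) (Σ xs f) (Σ ys f))

Σ-concat : ∀ (xss : List (List A)) f → Σ (concat xss) f ≡ Σ xss (λ xs → Σ xs f)
Σ-concat []         f = refl
Σ-concat (xs ∷ xss) f = trans (Σ-++ xs (concat xss) f) (cong (_+_ (Σ xs f)) (Σ-concat xss f))

Σ-map : ∀ (g : A → B) xs f → Σ (map g xs) f ≡ Σ xs (f ∘ g)
Σ-map g []       f = refl
Σ-map g (x ∷ xs) f = cong (_+_ (f (g x))) (Σ-map g xs f)

Σ-linear₄ : ∀ (xs : List A) (f g h k : A → ℤ) →
            Σ xs (λ z → f z - g z + h z + k z) ≡ Σ xs f - Σ xs g + Σ xs h + Σ xs k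
Σ-linear₄ []       f g h k = refl
Σ-linear₄ (x ∷ xs) f g h k rewrite Σ-linear₄ xs f g h k =
  shuffle (f x) (g x) (h x) (k x) (Σ xs f) (Σ xs g) (Σ xs h) (Σ xs k)
  where shuffle : ∀ a b c d s t u v → a - b + c + d + (s - t + u + v) ≡ (a + s) - (b + t) + (c + u) + (d + v)
        shuffle = solve-∀

Σ-complements : ∀ (xs : List A) (f g : A → ℤ) →
                Σ xs (λ z → (+ 1 - f z) * (+ 1 - g z))
                ≡ + length xs - Σ xs f - Σ xs g + Σ xs (λ z → f z * g z)
Σ-complements []       f g = refl
Σ-complements (x ∷ xs) f g rewrite Σ-complements xs f g =
  expand (f x) (g x) (+ length xs) (Σ xs f) (Σ xs g) (Σ xs (λ z → f z * g z))
  where expand : ∀ a b l s t r → (+ 1 - a) * (+ 1 - b) + (l - s - t + r)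
                                 ≡ (+ 1 + l) - (a + s) - (b + t) + (a * b + r)
        expand = solve-∀

Σ-double-complements :
  ∀ (xs : List A) (f f′ g g′ : A → ℤ) →
  Σ xs (λ z → (+ 1 - f z - f′ z) * (+ 1 - g z - g′ z))
  ≡ + length xs - Σ xs f - Σ xs f′ - Σ xs g - Σ xs g′
    + Σ xs (λ z → f z * g z) + Σ xs (λ z → f z * g′ z)
    + Σ xs (λ z → f′ z * g z) + Σ xs (λ z → f′ z * g′ z)
Σ-double-complements []       f f′ g g′ = refl
Σ-double-complements (x ∷ xs) f f′ g g′ rewrite Σ-double-complements xs f f′ g g′ =
  expand (f x) (f′ x) (g x) (g′ x) (+ length xs) (Σ xs f) (Σ xs f′) (Σ xs g) (Σ xs g′)
    (Σ xs (λ z → f z * g z)) (Σ xs (λ z → f z * g′ z))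
    (Σ xs (λ z → f′ z * g z)) (Σ xs (λ z → f′ z * g′ z))
  where expand : ∀ a a′ b b′ l s s′ t t′ u v w y →
                 (+ 1 - a - a′) * (+ 1 - b - b′) + (l - s - s′ - t - t′ + u + v + w + y)
                 ≡ (+ 1 + l) - (a + s) - (a′ + s′) - (b + t) - (b′ + t′)
                   + (a * b + u) + (a * b′ + v) + (a′ * b + w) + (a′ * b′ + y)
        expand = solve-∀

Σ< : ℕ → (ℕ → ℤ) → ℤ
Σ< zero    φ = + 0
Σ< (suc m) φ = Σ< m φ + φ m

Σ<-cong< : ∀ m {φ ψ : ℕ → ℤ} → (∀ {i} → i < m → φ i ≡ ψ i) → Σ< m φ ≡ Σ< m ψ
Σ<-cong< zero    eq = refl
Σ<-cong< (suc m) eq = cong₂ _+_ (Σ<-cong< m (eq ∘ ℕ.m<n⇒m<1+n)) (eq (ℕ.n<1+n m))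

Σ<-cong : ∀ m {φ ψ : ℕ → ℤ} → (∀ i → φ i ≡ ψ i) → Σ< m φ ≡ Σ< m ψ
Σ<-cong m eq = Σ<-cong< m (λ {i} _ → eq i)

Σ<-zero : ∀ m → Σ< m (λ _ → + 0) ≡ + 0
Σ<-zero zero    = refl
Σ<-zero (suc m) = trans (ℤ.+-identityʳ _) (Σ<-zero m)

Σ<-+ : ∀ m (φ ψ : ℕ → ℤ) → Σ< m (λ i → φ i + ψ i) ≡ Σ< m φ + Σ< m ψ
Σ<-+ zero    φ ψ = refl
Σ<-+ (suc m) φ ψ rewrite Σ<-+ m φ ψ = shuffle (Σ< m φ) (Σ< m ψ) (φ m) (ψ m)
  where shuffle : ∀ a b c d → a + b + (c + d) ≡ a + c + (b + d)
        shuffle = solve-∀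

Σ<-*ˡ : ∀ m k (φ : ℕ → ℤ) → Σ< m (λ i → k * φ i) ≡ k * Σ< m φ
Σ<-*ˡ zero    k φ = sym (ℤ.*-zeroʳ k)
Σ<-*ˡ (suc m) k φ rewrite Σ<-*ˡ m k φ = sym (ℤ.*-distribˡ-+ k (Σ< m φ) (φ m))

Σ<-const : ∀ m k → Σ< m (λ _ → k) ≡ + m * k
Σ<-const zero    k = refl
Σ<-const (suc m) k rewrite Σ<-const m k = step (+ m) k
  where step : ∀ m k → m * k + k ≡ (+ 1 + m) * k
        step = solve-∀

Σ<-shift : ∀ m φ → Σ< (suc m) φ ≡ φ 0 + Σ< m (φ ∘ suc)
Σ<-shift zero    φ = ℤ.+-comm (+ 0) (φ 0)
Σ<-shift (suc m) φ rewrite Σ<-shift m φ = ℤ.+-assoc (φ 0) (Σ< m (φ ∘ suc)) (φ (suc m))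

Σ<-δ : ∀ m a (ψ : ℕ → ℤ) → Σ< m (λ i → 𝟙[ a ℕ.≟ i ] * ψ i) ≡ 𝟙[ a ℕ.<? m ] * ψ a
Σ<-δ zero    a ψ = refl
Σ<-δ (suc m) a ψ = begin
  Σ< m (λ i → 𝟙[ a ℕ.≟ i ] * ψ i) + 𝟙[ a ℕ.≟ m ] * ψ m
    ≡⟨ cong₂ _+_ (Σ<-δ m a ψ) (𝟙-≡-subst (a ℕ.≟ m) ψ) ⟩
  𝟙[ a ℕ.<? m ] * ψ a + 𝟙[ a ℕ.≟ m ] * ψ a
    ≡˘⟨ ℤ.*-distribʳ-+ (ψ a) 𝟙[ a ℕ.<? m ] 𝟙[ a ℕ.≟ m ] ⟩
  (𝟙[ a ℕ.<? m ] + 𝟙[ a ℕ.≟ m ]) * ψ a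
    ≡˘⟨ cong (_* ψ a) (𝟙-<-suc a m) ⟩
  𝟙[ a ℕ.<? suc m ] * ψ a ∎
  where open ≡-Reasoning

Σ<-arith : ∀ m x y → + 2 * Σ< m (λ r → x + + r * y) ≡ + 2 * + m * x + + m * (+ m - + 1) * y
Σ<-arith zero    x y = refl
Σ<-arith (suc m) x y = begin
  + 2 * (Σ< m (λ r → x + + r * y) + (x + + m * y))
    ≡⟨ ℤ.*-distribˡ-+ (+ 2) (Σ< m (λ r → x + + r * y)) (x + + m * y) ⟩
  + 2 * Σ< m (λ r → x + + r * y) + + 2 * (x + + m * y)
    ≡⟨ cong (_+ + 2 * (x + + m * y)) (Σ<-arith m x y) ⟩
  + 2 * + m * x + + m * (+ m - + 1) * y + + 2 * (x + + m * y)
    ≡⟨ step (+ m) x y ⟩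
  + 2 * (+ 1 + + m) * x + (+ 1 + + m) * (+ 1 + + m - + 1) * y ∎
  where
  open ≡-Reasoning
  step : ∀ m x y → + 2 * m * x + m * (m - + 1) * y + + 2 * (x + m * y)
                   ≡ + 2 * (+ 1 + m) * x + (+ 1 + m) * (+ 1 + m - + 1) * y
  step = solve-∀

Σ-applyUpTo : ∀ (g : ℕ → A) m f → Σ (applyUpTo g m) f ≡ Σ< m (f ∘ g)
Σ-applyUpTo g zero    f = refl
Σ-applyUpTo g (suc m) f = trans (cong (_+_ (f (g 0))) (Σ-applyUpTo (g ∘ suc) m f))
                                (sym (Σ<-shift m (f ∘ g)))

Σ△ : ℕ → (ℕ → ℕ → ℤ) → ℤ
Σ△ N φ = Σ< N (λ r → Σ< (suc r) (φ r))

Σ△-cong< : ∀ N {φ ψ : ℕ → ℕ → ℤ} → (∀ {r j} → r < N → j ≤ r → φ r j ≡ ψ r j) →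
           Σ△ N φ ≡ Σ△ N ψ
Σ△-cong< N eq = Σ<-cong< N (λ r< → Σ<-cong< _ (λ j< → eq r< (ℕ.≤-pred j<)))

Σ△-cong : ∀ N {φ ψ : ℕ → ℕ → ℤ} → (∀ r j → φ r j ≡ ψ r j) → Σ△ N φ ≡ Σ△ N ψ
Σ△-cong N eq = Σ<-cong N (λ r → Σ<-cong (suc r) (eq r))

Σ△-zero : ∀ N → Σ△ N (λ _ _ → + 0) ≡ + 0
Σ△-zero N = trans (Σ<-cong N (λ r → Σ<-zero (suc r))) (Σ<-zero N)

Σ△-+ : ∀ N (φ ψ : ℕ → ℕ → ℤ) → Σ△ N (λ r j → φ r j + ψ r j) ≡ Σ△ N φ + Σ△ N ψ
Σ△-+ N φ ψ = trans (Σ<-cong N (λ r → Σ<-+ (suc r) (φ r) (ψ r))) (Σ<-+ N _ _)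

Σ△-δ : ∀ N a b (ψ : ℕ → ℕ → ℤ) →
       Σ△ N (λ r j → 𝟙[ a ℕ.≟ r ] * (𝟙[ b ℕ.≟ j ] * ψ r j))
       ≡ 𝟙[ a ℕ.<? N ] * (𝟙[ b ℕ.<? suc a ] * ψ a b)
Σ△-δ N a b ψ = trans
  (Σ<-cong N (λ r → trans (Σ<-*ˡ (suc r) 𝟙[ a ℕ.≟ r ] (λ j → 𝟙[ b ℕ.≟ j ] * ψ r j))
                          (cong (𝟙[ a ℕ.≟ r ] *_) (Σ<-δ (suc r) b (ψ r)))))
  (Σ<-δ N a (λ r → 𝟙[ b ℕ.<? suc r ] * ψ r b))

Σ△-δ₁ : ∀ N a b →
        Σ△ N (λ r j → 𝟙[ a ℕ.≟ r ] * 𝟙[ b ℕ.≟ j ]) ≡ 𝟙[ a ℕ.<? N ] * 𝟙[ b ℕ.<? suc a ]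
Σ△-δ₁ N a b = begin
  Σ△ N (λ r j → 𝟙[ a ℕ.≟ r ] * 𝟙[ b ℕ.≟ j ])
    ≡˘⟨ Σ△-cong N (λ r j → cong (𝟙[ a ℕ.≟ r ] *_) (ℤ.*-identityʳ 𝟙[ b ℕ.≟ j ])) ⟩
  Σ△ N (λ r j → 𝟙[ a ℕ.≟ r ] * (𝟙[ b ℕ.≟ j ] * + 1))
    ≡⟨ Σ△-δ N a b (λ _ _ → + 1) ⟩
  𝟙[ a ℕ.<? N ] * (𝟙[ b ℕ.<? suc a ] * + 1)
    ≡⟨ cong (𝟙[ a ℕ.<? N ] *_) (ℤ.*-identityʳ 𝟙[ b ℕ.<? suc a ]) ⟩
  𝟙[ a ℕ.<? N ] * 𝟙[ b ℕ.<? suc a ] ∎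
  where open ≡-Reasoning

-- Sums over 3-subsets and over ordered triples

Σ₂ : List A → (A → A → ℤ) → ℤ
Σ₂ []       k = + 0
Σ₂ (x ∷ xs) k = Σ xs (k x) + Σ₂ xs k

Σ₃ : List A → (A → A → A → ℤ) → ℤ
Σ₃ []       h = + 0
Σ₃ (x ∷ xs) h = Σ₂ xs (h x) + Σ₃ xs h

length-filter-∷ : ∀ {P : A → Set} (P? : Unary.Decidable P) x xs →
                  + length (filter P? (x ∷ xs)) ≡ 𝟙[ P? x ] + + length (filter P? xs)
length-filter-∷ P? x xs with does (P? x)
... | true  = refl
... | false = refl

length-filter-++ : ∀ {P : A → Set} (P? : Unary.Decidable P) xs ys →
                   + length (filter P? (xs ++ ys)) ≡ + length (filter P? xs) + + length (filter P? ys)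
length-filter-++ P? xs ys rewrite filter-++ P? xs ys | length-++ (filter P? xs) {filter P? ys} = refl

module _ {R : A → A → Set} (R? : Binary.Decidable R) where

  pairwise₃ : A → A → A → ℤ
  pairwise₃ x y z = 𝟙[ R? x y ] * 𝟙[ R? x z ] * 𝟙[ R? y z ]

  private
    #pairwise : List (List A) → ℤ
    #pairwise ls = + length (filter (allPairs? R?) ls)

    𝟙-allPairs₃ : ∀ x y z → 𝟙[ allPairs? R? (x ∷ y ∷ z ∷ []) ] ≡ pairwise₃ x y z
    𝟙-allPairs₃ x y z with does (R? x y) | does (R? x z) | does (R? y z)
    ... | true  | true  | true  = refl
    ... | true  | true  | false = refl
    ... | true  | false | _     = refl
    ... | false | _     | _     = refl

    #pairwise-∷∷ : ∀ x y zs → #pairwise (map (x ∷_) (map (y ∷_) (sublists 1 zs))) ≡ Σ zs (pairwise₃ x y)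
    #pairwise-∷∷ x y []       = refl
    #pairwise-∷∷ x y (z ∷ zs) =
      trans (length-filter-∷ (allPairs? R?) (x ∷ y ∷ z ∷ []) _)
            (cong₂ _+_ (𝟙-allPairs₃ x y z) (#pairwise-∷∷ x y zs))

    #pairwise-∷ : ∀ x ys → #pairwise (map (x ∷_) (sublists 2 ys)) ≡ Σ₂ ys (pairwise₃ x)
    #pairwise-∷ x []       = refl
    #pairwise-∷ x (y ∷ ys) = begin
      #pairwise (map (x ∷_) (map (y ∷_) (sublists 1 ys) ++ sublists 2 ys))
        ≡⟨ cong #pairwise (map-++ (x ∷_) (map (y ∷_) (sublists 1 ys)) (sublists 2 ys)) ⟩
      #pairwise (map (x ∷_) (map (y ∷_) (sublists 1 ys)) ++ map (x ∷_) (sublists 2 ys))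
        ≡⟨ length-filter-++ (allPairs? R?) (map (x ∷_) (map (y ∷_) (sublists 1 ys))) _ ⟩
      #pairwise (map (x ∷_) (map (y ∷_) (sublists 1 ys))) + #pairwise (map (x ∷_) (sublists 2 ys))
        ≡⟨ cong₂ _+_ (#pairwise-∷∷ x y ys) (#pairwise-∷ x ys) ⟩
      Σ₂ (y ∷ ys) (pairwise₃ x) ∎
      where open ≡-Reasoning

  #pairwise-sublists₃ : ∀ xs → + length (filter (allPairs? R?) (sublists 3 xs)) ≡ Σ₃ xs pairwise₃
  #pairwise-sublists₃ []       = refl
  #pairwise-sublists₃ (x ∷ xs) =
    trans (length-filter-++ (allPairs? R?) (map (x ∷_) (sublists 2 xs)) (sublists 3 xs))
          (cong₂ _+_ (#pairwise-∷ x xs) (#pairwise-sublists₃ xs))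

Σ-∷² : ∀ a xs (k : A → A → ℤ) →
       Σ (a ∷ xs) (λ y → Σ (a ∷ xs) (k y))
       ≡ k a a + Σ xs (k a) + Σ xs (λ y → k y a) + Σ xs (λ y → Σ xs (k y))
Σ-∷² a xs k = trans (cong (_+_ (k a a + Σ xs (k a))) (Σ-+ xs (λ y → k y a) (λ y → Σ xs (k y))))
                    (sym (ℤ.+-assoc (k a a + Σ xs (k a)) _ _))

Σ-ordered-pairs : ∀ xs (k : A → A → ℤ) → (∀ x → k x x ≡ + 0) → (∀ x y → k x y ≡ k y x) →
                  Σ xs (λ x → Σ xs (k x)) ≡ + 2 * Σ₂ xs k
Σ-ordered-pairs []       k diag sym-k = refl
Σ-ordered-pairs (a ∷ xs) k diag sym-k = begin
  Σ (a ∷ xs) (λ x → Σ (a ∷ xs) (k x))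
    ≡⟨ Σ-∷² a xs k ⟩
  k a a + Σ xs (k a) + Σ xs (λ y → k y a) + Σ xs (λ x → Σ xs (k x))
    ≡⟨ cong₂ (λ u v → u + Σ xs (k a) + v + Σ xs (λ x → Σ xs (k x)))
             (diag a) (Σ-cong xs (λ y → sym-k y a)) ⟩
  + 0 + Σ xs (k a) + Σ xs (k a) + Σ xs (λ x → Σ xs (k x))
    ≡⟨ cong (_+_ (+ 0 + Σ xs (k a) + Σ xs (k a))) (Σ-ordered-pairs xs k diag sym-k) ⟩
  + 0 + Σ xs (k a) + Σ xs (k a) + + 2 * Σ₂ xs k
    ≡⟨ collect (Σ xs (k a)) (Σ₂ xs k) ⟩
  + 2 * Σ₂ (a ∷ xs) k ∎
  where
  open ≡-Reasoning
  collect : ∀ s t → + 0 + s + s + + 2 * t ≡ + 2 * (s + t)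
  collect = solve-∀

module _ (h : A → A → A → ℤ)
         (sym₁₂ : ∀ x y z → h x y z ≡ h y x z)
         (sym₂₃ : ∀ x y z → h x y z ≡ h x z y)
         (diag : ∀ x z → h x x z ≡ + 0)
         where

  private
    diag₂₃ : ∀ x y → h x y y ≡ + 0
    diag₂₃ x y = trans (sym₁₂ x y y) (trans (sym₂₃ y x y) (diag y x))

    diag₁₃ : ∀ x y → h x y x ≡ + 0
    diag₁₃ x y = trans (sym₂₃ x y x) (diag x y)

    Σ²-∷-first : ∀ a xs → Σ (a ∷ xs) (λ y → Σ (a ∷ xs) (h a y)) ≡ Σ xs (λ y → Σ xs (h a y))
    Σ²-∷-first a xs = begin
      Σ (a ∷ xs) (λ y → Σ (a ∷ xs) (h a y))
        ≡⟨ Σ-∷² a xs (h a) ⟩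
      h a a a + Σ xs (h a a) + Σ xs (λ y → h a y a) + Σ xs (λ y → Σ xs (h a y))
        ≡⟨ cong₂ (λ u v → u + v + Σ xs (λ y → Σ xs (h a y)))
             (cong₂ _+_ (diag a a) (trans (Σ-cong xs (diag a)) (Σ-zero xs)))
             (trans (Σ-cong xs (diag₁₃ a)) (Σ-zero xs)) ⟩
      + 0 + + 0 + + 0 + Σ xs (λ y → Σ xs (h a y))
        ≡⟨ ℤ.+-identityˡ _ ⟩
      Σ xs (λ y → Σ xs (h a y)) ∎
      where open ≡-Reasoning

    Σ²-∷-other : ∀ a xs x → Σ (a ∷ xs) (λ y → Σ (a ∷ xs) (h x y))
                            ≡ + 2 * Σ xs (h a x) + Σ xs (λ y → Σ xs (h x y))
    Σ²-∷-other a xs x = begin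
      Σ (a ∷ xs) (λ y → Σ (a ∷ xs) (h x y))
        ≡⟨ Σ-∷² a xs (h x) ⟩
      h x a a + Σ xs (h x a) + Σ xs (λ y → h x y a) + Σ xs (λ y → Σ xs (h x y))
        ≡⟨ cong₂ (λ u v → u + v + Σ xs (λ y → Σ xs (h x y)))
             (cong₂ _+_ (diag₂₃ x a) (Σ-cong xs (sym₁₂ x a)))
             (Σ-cong xs (λ y → trans (sym₂₃ x y a) (sym₁₂ x a y))) ⟩
      + 0 + Σ xs (h a x) + Σ xs (h a x) + Σ xs (λ y → Σ xs (h x y))
        ≡⟨ collect (Σ xs (h a x)) _ ⟩
      + 2 * Σ xs (h a x) + Σ xs (λ y → Σ xs (h x y)) ∎
      where
      open ≡-Reasoning
      collect : ∀ s t → + 0 + s + s + t ≡ + 2 * s + t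
      collect = solve-∀

  Σ-ordered-triples : ∀ xs → Σ xs (λ x → Σ xs (λ y → Σ xs (h x y))) ≡ + 6 * Σ₃ xs h
  Σ-ordered-triples []       = refl
  Σ-ordered-triples (a ∷ xs) = begin
    Σ (a ∷ xs) (λ y → Σ (a ∷ xs) (h a y)) + Σ xs (λ x → Σ (a ∷ xs) (λ y → Σ (a ∷ xs) (h x y)))
      ≡⟨ cong₂ _+_ (Σ²-∷-first a xs) (Σ-cong xs (Σ²-∷-other a xs)) ⟩
    Σ² (h a) + Σ xs (λ x → + 2 * Σ xs (h a x) + Σ² (h x))
      ≡⟨ cong (_+_ (Σ² (h a))) (trans (Σ-+ xs _ _)
                                     (cong (_+ Σ xs (λ x → Σ² (h x))) (Σ-*ˡ xs (+ 2) (λ x → Σ xs (h a x))))) ⟩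
    Σ² (h a) + (+ 2 * Σ² (h a) + Σ xs (λ x → Σ² (h x)))
      ≡⟨ cong₂ (λ u v → u + (+ 2 * u + v))
           (Σ-ordered-pairs xs (h a) (diag₂₃ a) (sym₂₃ a)) (Σ-ordered-triples xs) ⟩
    + 2 * Σ₂ xs (h a) + (+ 2 * (+ 2 * Σ₂ xs (h a)) + + 6 * Σ₃ xs h)
      ≡⟨ collect (Σ₂ xs (h a)) (Σ₃ xs h) ⟩
    + 6 * Σ₃ (a ∷ xs) h ∎
    where
    open ≡-Reasoning
    Σ² : (A → A → ℤ) → ℤ
    Σ² k = Σ xs (λ y → Σ xs (k y))
    collect : ∀ s t → + 2 * s + (+ 2 * (+ 2 * s) + + 6 * t) ≡ + 6 * (s + t)
    collect = solve-∀

-- Compatibility of inner edges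

δ : Tri → Tri → ℤ
δ s t = 𝟙[ s ≟T t ]

sameDown sameUp : Edge → Edge → ℤ
sameDown e f = δ (downSide e) (downSide f)
sameUp   e f = δ (upSide e) (upSide f)

compat : Edge → Edge → ℤ
compat e f = 𝟙[ compatible? e f ]

compat-δ : ∀ e f → compat e f ≡ (+ 1 - sameDown e f) * (+ 1 - sameUp e f)
compat-δ e f with does (downSide e ≟T downSide f) | does (upSide e ≟T upSide f)
... | true  | true  = refl
... | true  | false = refl
... | false | true  = refl
... | false | false = refl

δ-sym : ∀ s t → δ s t ≡ δ t s
δ-sym s t = 𝟙-cong sym sym (s ≟T t) (t ≟T s)

δ-transitive : ∀ s t u → (+ 1 - δ s t) * δ s u * δ t u ≡ + 0
δ-transitive s t u = begin
  (+ 1 - δ s t) * δ s u * δ t u    ≡⟨ ℤ.*-assoc (+ 1 - δ s t) (δ s u) (δ t u) ⟩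
  (+ 1 - δ s t) * (δ s u * δ t u)  ≡⟨ cong ((+ 1 - δ s t) *_) (𝟙-≡-subst (s ≟T u) (δ t)) ⟩
  (+ 1 - δ s t) * (δ s u * δ t s)  ≡⟨ cong (λ x → (+ 1 - δ s t) * (δ s u * x)) (δ-sym t s) ⟩
  (+ 1 - δ s t) * (δ s u * δ s t)  ≡⟨ expand (δ s t) (δ s u) ⟩
  δ s u * (δ s t - δ s t * δ s t)  ≡⟨ cong (λ x → δ s u * (δ s t - x)) (𝟙-idem (s ≟T t)) ⟩
  δ s u * (δ s t - δ s t)          ≡⟨ cong (δ s u *_) (ℤ.+-inverseʳ (δ s t)) ⟩
  δ s u * + 0                      ≡⟨ ℤ.*-zeroʳ (δ s u) ⟩
  + 0                              ∎
  where
  open ≡-Reasoning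
  expand : ∀ x y → (+ 1 - x) * (y * x) ≡ y * (x - x * x)
  expand = solve-∀

compat-irrefl : ∀ e → compat e e ≡ + 0
compat-irrefl e = 𝟙-no (compatible? e e) (λ (d≢d , _) → d≢d refl)

compat-sym : ∀ e f → compat e f ≡ compat f e
compat-sym e f = 𝟙-cong swap swap (compatible? e f) (compatible? f e)
  where swap : ∀ {e f} → Compatible e f → Compatible f e
        swap (d≢ , u≢) = d≢ ∘ sym , u≢ ∘ sym

δ-transfer : ∀ s t u → δ s u * (+ 1 - δ s t) ≡ δ u s * (+ 1 - δ u t)
δ-transfer s t u = trans (sym (𝟙-≡-subst (s ≟T u) (λ w → + 1 - δ w t)))
                         (cong (_* (+ 1 - δ u t)) (δ-sym s u))

complements-absorb : ∀ α A₁ A₂ → (+ 1 - α) * A₁ * A₂ ≡ + 0 →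
                   (+ 1 - α) * (+ 1 - A₁) * (+ 1 - A₂) ≡ (+ 1 - α) * (+ 1 - A₁ - A₂)
complements-absorb α A₁ A₂ vanish = begin
  (+ 1 - α) * (+ 1 - A₁) * (+ 1 - A₂)                   ≡⟨ expand α A₁ A₂ ⟩
  (+ 1 - α) * (+ 1 - A₁ - A₂) + (+ 1 - α) * A₁ * A₂      ≡⟨ cong (_+_ ((+ 1 - α) * (+ 1 - A₁ - A₂))) vanish ⟩
  (+ 1 - α) * (+ 1 - A₁ - A₂) + + 0                     ≡⟨ ℤ.+-identityʳ _ ⟩
  (+ 1 - α) * (+ 1 - A₁ - A₂)                           ∎
  where
  open ≡-Reasoning
  expand : ∀ α A₁ A₂ → (+ 1 - α) * (+ 1 - A₁) * (+ 1 - A₂)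
                       ≡ (+ 1 - α) * (+ 1 - A₁ - A₂) + (+ 1 - α) * A₁ * A₂
  expand = solve-∀

compat₃-δ : ∀ x y z → pairwise₃ compatible? x y z
            ≡ compat x y * ((+ 1 - sameDown x z - sameDown y z) * (+ 1 - sameUp x z - sameUp y z))
compat₃-δ x y z = begin
  compat x y * compat x z * compat y z
    ≡⟨ cong₂ _*_ (cong₂ _*_ (compat-δ x y) (compat-δ x z)) (compat-δ y z) ⟩
  (+ 1 - α) * (+ 1 - β) * ((+ 1 - A₁) * (+ 1 - B₁)) * ((+ 1 - A₂) * (+ 1 - B₂))
    ≡⟨ regroup α β A₁ A₂ B₁ B₂ ⟩
  ((+ 1 - α) * (+ 1 - A₁) * (+ 1 - A₂)) * ((+ 1 - β) * (+ 1 - B₁) * (+ 1 - B₂))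
    ≡⟨ cong₂ _*_ (complements-absorb α A₁ A₂ (δ-transitive (downSide x) (downSide y) (downSide z)))
                 (complements-absorb β B₁ B₂ (δ-transitive (upSide x) (upSide y) (upSide z))) ⟩
  ((+ 1 - α) * (+ 1 - A₁ - A₂)) * ((+ 1 - β) * (+ 1 - B₁ - B₂))
    ≡⟨ regroup′ α β A₁ A₂ B₁ B₂ ⟩
  (+ 1 - α) * (+ 1 - β) * ((+ 1 - A₁ - A₂) * (+ 1 - B₁ - B₂))
    ≡˘⟨ cong (_* ((+ 1 - A₁ - A₂) * (+ 1 - B₁ - B₂))) (compat-δ x y) ⟩
  compat x y * ((+ 1 - A₁ - A₂) * (+ 1 - B₁ - B₂)) ∎
  where
  open ≡-Reasoning
  α = sameDown x y
  β = sameUp x y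
  A₁ = sameDown x z
  A₂ = sameDown y z
  B₁ = sameUp x z
  B₂ = sameUp y z
  regroup : ∀ α β A₁ A₂ B₁ B₂ →
            (+ 1 - α) * (+ 1 - β) * ((+ 1 - A₁) * (+ 1 - B₁)) * ((+ 1 - A₂) * (+ 1 - B₂))
            ≡ ((+ 1 - α) * (+ 1 - A₁) * (+ 1 - A₂)) * ((+ 1 - β) * (+ 1 - B₁) * (+ 1 - B₂))
  regroup = solve-∀
  regroup′ : ∀ α β A₁ A₂ B₁ B₂ →
             ((+ 1 - α) * (+ 1 - A₁ - A₂)) * ((+ 1 - β) * (+ 1 - B₁ - B₂))
             ≡ (+ 1 - α) * (+ 1 - β) * ((+ 1 - A₁ - A₂) * (+ 1 - B₁ - B₂))
  regroup′ = solve-∀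

-- Once x, z share their downward triangle and y, z their upward one, the compatibility of
-- x and y is decided at z.
compat-mixed : ∀ x y z → compat x y * (sameDown x z * sameUp y z)
               ≡ (sameDown z x - sameDown z x * sameUp z x) * (sameUp z y - sameDown z y * sameUp z y)
compat-mixed x y z = begin
  compat x y * (sameDown x z * sameUp y z)
    ≡⟨ cong (_* (sameDown x z * sameUp y z)) (compat-δ x y) ⟩
  (+ 1 - sameDown x y) * (+ 1 - sameUp x y) * (sameDown x z * sameUp y z)
    ≡⟨ regroup (sameDown x y) (sameUp x y) (sameDown x z) (sameUp y z) ⟩
  (sameDown x z * (+ 1 - sameDown x y)) * (sameUp y z * (+ 1 - sameUp x y))
    ≡⟨ cong (λ b → (sameDown x z * (+ 1 - sameDown x y)) * (sameUp y z * (+ 1 - b))) (δ-sym (upSide x) (upSide y)) ⟩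
  (sameDown x z * (+ 1 - sameDown x y)) * (sameUp y z * (+ 1 - sameUp y x))
    ≡⟨ cong₂ _*_ (δ-transfer (downSide x) (downSide y) (downSide z)) (δ-transfer (upSide y) (upSide x) (upSide z)) ⟩
  (sameDown z x * (+ 1 - sameDown z y)) * (sameUp z y * (+ 1 - sameUp z x))
    ≡⟨ regroup′ (sameDown z x) (sameDown z y) (sameUp z y) (sameUp z x) ⟩
  (sameDown z x - sameDown z x * sameUp z x) * (sameUp z y - sameDown z y * sameUp z y) ∎
  where
  open ≡-Reasoning
  regroup : ∀ α β a b → (+ 1 - α) * (+ 1 - β) * (a * b) ≡ (a * (+ 1 - α)) * (b * (+ 1 - β))
  regroup = solve-∀
  regroup′ : ∀ a a′ b b′ → (a * (+ 1 - a′)) * (b * (+ 1 - b′)) ≡ (a - a * b′) * (b - a′ * b)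
  regroup′ = solve-∀

Φ : ℤ → ℤ → ℤ → ℤ
Φ E P Q = (E + + 2 - + 2 * P - + 2 * Q) * (E + + 1 - P - Q) + + 2 * (P - + 1) * (Q - + 1)

module Incidence (xs : List Edge) where

  E : ℤ
  E = + length xs

  downDegree upDegree multiplicity : Edge → ℤ
  downDegree x   = Σ xs (sameDown x)
  upDegree x     = Σ xs (sameUp x)
  multiplicity x = Σ xs (λ z → sameDown x z * sameUp x z)

  mixedDegree : Edge → Edge → ℤ
  mixedDegree x y = Σ xs (λ z → sameDown x z * sameUp y z)

  Σ-compat : ∀ x → multiplicity x ≡ + 1 → Σ xs (compat x) ≡ E + + 1 - downDegree x - upDegree x
  Σ-compat x simple = begin
    Σ xs (compat x)
      ≡⟨ Σ-cong xs (compat-δ x) ⟩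
    Σ xs (λ z → (+ 1 - sameDown x z) * (+ 1 - sameUp x z))
      ≡⟨ Σ-complements xs (sameDown x) (sameUp x) ⟩
    E - downDegree x - upDegree x + multiplicity x
      ≡⟨ cong (_+_ (E - downDegree x - upDegree x)) simple ⟩
    E - downDegree x - upDegree x + + 1
      ≡⟨ reorder E (downDegree x) (upDegree x) ⟩
    E + + 1 - downDegree x - upDegree x ∎
    where
    open ≡-Reasoning
    reorder : ∀ E p q → E - p - q + + 1 ≡ E + + 1 - p - q
    reorder = solve-∀

  Σ-compat₃ : ∀ x y → multiplicity x ≡ + 1 → multiplicity y ≡ + 1 →
              Σ xs (pairwise₃ compatible? x y)
              ≡ compat x y * (E + + 2 - downDegree x - upDegree x - (downDegree y + upDegree y)
                              + mixedDegree x y + mixedDegree y x)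
  Σ-compat₃ x y simple-x simple-y = begin
    Σ xs (pairwise₃ compatible? x y)
      ≡⟨ Σ-cong xs (compat₃-δ x y) ⟩
    Σ xs (λ z → compat x y * ((+ 1 - sameDown x z - sameDown y z) * (+ 1 - sameUp x z - sameUp y z)))
      ≡⟨ Σ-*ˡ xs (compat x y) _ ⟩
    compat x y * Σ xs (λ z → (+ 1 - sameDown x z - sameDown y z) * (+ 1 - sameUp x z - sameUp y z))
      ≡⟨ cong (compat x y *_) (Σ-double-complements xs (sameDown x) (sameDown y) (sameUp x) (sameUp y)) ⟩
    compat x y * (E - downDegree x - downDegree y - upDegree x - upDegree y
                  + multiplicity x + mixedDegree x y + mixedDegree y x + multiplicity y)
      ≡⟨ cong₂ (λ u v → compat x y * (E - downDegree x - downDegree y - upDegree x - upDegree y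
                                       + u + mixedDegree x y + mixedDegree y x + v)) simple-x simple-y ⟩
    compat x y * (E - downDegree x - downDegree y - upDegree x - upDegree y
                  + + 1 + mixedDegree x y + mixedDegree y x + + 1)
      ≡⟨ cong (compat x y *_) (reorder E (downDegree x) (downDegree y) (upDegree x) (upDegree y)
                                        (mixedDegree x y) (mixedDegree y x)) ⟩
    compat x y * (E + + 2 - downDegree x - upDegree x - (downDegree y + upDegree y)
                  + mixedDegree x y + mixedDegree y x) ∎
    where
    open ≡-Reasoning
    reorder : ∀ E px py qx qy mxy myx → E - px - py - qx - qy + + 1 + mxy + myx + + 1
                                         ≡ E + + 2 - px - qx - (py + qy) + mxy + myx
    reorder = solve-∀

  Σ-compat-mixed : All (λ x → multiplicity x ≡ + 1) xs →
                   Σ xs (λ x → Σ xs (λ y → compat x y * mixedDegree x y))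
                   ≡ Σ xs (λ z → (downDegree z - + 1) * (upDegree z - + 1))
  Σ-compat-mixed simple = begin
    Σ xs (λ x → Σ xs (λ y → compat x y * mixedDegree x y))
      ≡˘⟨ Σ-cong xs (λ x → Σ-cong xs (λ y → Σ-*ˡ xs (compat x y) (λ z → sameDown x z * sameUp y z))) ⟩
    Σ xs (λ x → Σ xs (λ y → Σ xs (λ z → compat x y * (sameDown x z * sameUp y z))))
      ≡⟨ Σ-cong xs (λ x → Σ-swap xs xs _) ⟩
    Σ xs (λ x → Σ xs (λ z → Σ xs (λ y → compat x y * (sameDown x z * sameUp y z))))
      ≡⟨ Σ-swap xs xs _ ⟩
    Σ xs (λ z → Σ xs (λ x → Σ xs (λ y → compat x y * (sameDown x z * sameUp y z))))
      ≡⟨ Σ-cong xs (λ z → Σ-cong xs (λ x → Σ-cong xs (λ y → compat-mixed x y z))) ⟩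
    Σ xs (λ z → Σ xs (λ x → Σ xs (λ y → (sameDown z x - sameDown z x * sameUp z x)
                                        * (sameUp z y - sameDown z y * sameUp z y))))
      ≡⟨ Σ-cong xs (λ z → Σ-product xs xs _ _) ⟩
    Σ xs (λ z → Σ xs (λ x → sameDown z x - sameDown z x * sameUp z x)
              * Σ xs (λ y → sameUp z y - sameDown z y * sameUp z y))
      ≡⟨ Σ-cong xs (λ z → cong₂ _*_ (Σ-- xs _ _) (Σ-- xs _ _)) ⟩
    Σ xs (λ z → (downDegree z - multiplicity z) * (upDegree z - multiplicity z))
      ≡⟨ Σ-cong-All simple (λ {z} simple-z → cong (λ u → (downDegree z - u) * (upDegree z - u)) simple-z) ⟩
    Σ xs (λ z → (downDegree z - + 1) * (upDegree z - + 1)) ∎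
    where open ≡-Reasoning

  Σ²-compat-flip : ∀ (F : Edge → Edge → ℤ) →
                   Σ xs (λ x → Σ xs (λ y → compat x y * F y x)) ≡ Σ xs (λ x → Σ xs (λ y → compat x y * F x y))
  Σ²-compat-flip F = trans (Σ-swap xs xs _) (Σ-cong xs (λ y → Σ-cong xs (λ x → cong (_* F y x) (compat-sym x y))))

  Σ²-compat-left : ∀ (f : Edge → ℤ) →
                   Σ xs (λ x → Σ xs (λ y → compat x y * f x)) ≡ Σ xs (λ x → Σ xs (compat x) * f x)
  Σ²-compat-left f = Σ-cong xs (λ x → Σ-*ʳ xs (f x) (compat x))

  Σ-compat-triples : All (λ x → multiplicity x ≡ + 1) xs →
                     Σ xs (λ x → Σ xs (λ y → Σ xs (pairwise₃ compatible? x y)))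
                     ≡ Σ xs (λ x → Φ E (downDegree x) (upDegree x))
  Σ-compat-triples simple = begin
    Σ xs (λ x → Σ xs (λ y → Σ xs (pairwise₃ compatible? x y)))
      ≡⟨ Σ-cong-All simple (λ {x} simple-x → Σ-cong-All simple (λ {y} simple-y →
           trans (Σ-compat₃ x y simple-x simple-y)
                 (distribute (compat x y) (G x) (H y) (mixedDegree x y) (mixedDegree y x)))) ⟩
    Σ xs (λ x → Σ xs (λ y → compat x y * G x - compat x y * H y
                            + compat x y * mixedDegree x y + compat x y * mixedDegree y x))
      ≡⟨ trans (Σ-cong xs (λ x → Σ-linear₄ xs _ _ _ _)) (Σ-linear₄ xs _ _ _ _) ⟩
    Σ² (λ x y → compat x y * G x) - Σ² (λ x y → compat x y * H y)
      + Σ² (λ x y → compat x y * mixedDegree x y) + Σ² (λ x y → compat x y * mixedDegree y x)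
      ≡⟨ cong-linear₄ (Σ²-compat-left G)
                      (trans (Σ²-compat-flip (λ x _ → H x)) (Σ²-compat-left H))
                      (Σ-compat-mixed simple)
                      (trans (Σ²-compat-flip mixedDegree) (Σ-compat-mixed simple)) ⟩
    Σ xs (λ x → K x * G x) - Σ xs (λ x → K x * H x) + Σ xs C + Σ xs C
      ≡˘⟨ Σ-linear₄ xs (λ x → K x * G x) (λ x → K x * H x) C C ⟩
    Σ xs (λ x → K x * G x - K x * H x + C x + C x)
      ≡⟨ Σ-cong-All simple (λ {x} simple-x →
           trans (cong (λ k → k * G x - k * H x + C x + C x) (Σ-compat x simple-x))
                 (collect E (downDegree x) (upDegree x))) ⟩
    Σ xs (λ x → Φ E (downDegree x) (upDegree x)) ∎
    where
    open ≡-Reasoning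
    Σ² : (Edge → Edge → ℤ) → ℤ
    Σ² F = Σ xs (λ x → Σ xs (F x))
    G H K C : Edge → ℤ
    G x = E + + 2 - downDegree x - upDegree x
    H y = downDegree y + upDegree y
    K x = Σ xs (compat x)
    C z = (downDegree z - + 1) * (upDegree z - + 1)
    cong-linear₄ : ∀ {a a′ b b′ c c′ d d′ : ℤ} → a ≡ a′ → b ≡ b′ → c ≡ c′ → d ≡ d′ →
                   a - b + c + d ≡ a′ - b′ + c′ + d′
    cong-linear₄ refl refl refl refl = refl
    distribute : ∀ c g h m m′ → c * (g - h + m + m′) ≡ c * g - c * h + c * m + c * m′
    distribute = solve-∀
    collect : ∀ E p q → (E + + 1 - p - q) * (E + + 2 - p - q) - (E + + 1 - p - q) * (p + q)
                        + (p - + 1) * (q - + 1) + (p - + 1) * (q - + 1)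
                        ≡ (E + + 2 - + 2 * p - + 2 * q) * (E + + 1 - p - q) + + 2 * (p - + 1) * (q - + 1)
    collect = solve-∀

-- Degrees in the triangular grid

sides : ℕ → ℕ → List Edge
sides i j = map (λ k → (i , j , k)) (allFin 3)

Σ-innerEdges : ∀ n (φ : Edge → ℤ) →
               Σ (innerEdges n) φ ≡ Σ△ (n ∸ 1) (λ r j → Σ (sides (suc r) j) φ)
Σ-innerEdges n φ = begin
  Σ (concat (map row (upTo (n ∸ 1)))) φ
    ≡⟨ Σ-concat (map row (upTo (n ∸ 1))) φ ⟩
  Σ (map row (upTo (n ∸ 1))) (λ es → Σ es φ)
    ≡⟨ Σ-map row (upTo (n ∸ 1)) (λ es → Σ es φ) ⟩
  Σ (upTo (n ∸ 1)) (λ r → Σ (row r) φ)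
    ≡⟨ Σ-applyUpTo (λ r → r) (n ∸ 1) (λ r → Σ (row r) φ) ⟩
  Σ< (n ∸ 1) (λ r → Σ (row r) φ)
    ≡⟨ Σ<-cong (n ∸ 1) (λ r →
         trans (Σ-concat (map (sides (suc r)) (upTo (suc r))) φ)
        (trans (Σ-map (sides (suc r)) (upTo (suc r)) (λ es → Σ es φ))
               (Σ-applyUpTo (λ j → j) (suc r) (λ j → Σ (sides (suc r) j) φ)))) ⟩
  Σ< (n ∸ 1) (λ r → Σ< (suc r) (λ j → Σ (sides (suc r) j) φ)) ∎
  where
  open ≡-Reasoning
  row : ℕ → List Edge
  row r = concat (map (sides (suc r)) (upTo (suc r)))

All-innerEdges : ∀ n {P : Edge → Set} → (∀ r j k → r < n ∸ 1 → j ≤ r → P (suc r , j , k)) →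
                 All P (innerEdges n)
All-innerEdges n p =
  All.concat⁺ (All.map⁺ (All.applyUpTo⁺₁ (λ r → r) (n ∸ 1) (λ {r} r< →
    All.concat⁺ (All.map⁺ (All.applyUpTo⁺₁ (λ j → j) (suc r) (λ {j} j< →
      let j≤r = ℕ.≤-pred j< in
      p r j 0F r< j≤r ∷ p r j (sucF 0F) r< j≤r ∷ p r j (sucF (sucF 0F)) r< j≤r ∷ []))))))

δ-coords : ∀ β a b c d → δ (β , a , b) (β , c , d) ≡ 𝟙[ a ℕ.≟ c ] * 𝟙[ b ℕ.≟ d ]
δ-coords β a b c d =
  trans (𝟙-cong (λ { refl → refl , refl }) (λ { (refl , refl) → refl })
                ((β , a , b) ≟T (β , c , d)) ((a ℕ.≟ c) ×-dec (b ℕ.≟ d)))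
        (𝟙-∧ (does (a ℕ.≟ c)) (does (b ℕ.≟ d)))

δ-refl : ∀ s → δ s s ≡ + 1
δ-refl s = 𝟙-yes (s ≟T s) refl

δ-≢-row : ∀ β i j i′ j′ → i ≢ i′ → δ (β , i , j) (β , i′ , j′) ≡ + 0
δ-≢-row β i j i′ j′ i≢i′ = 𝟙-no ((β , i , j) ≟T (β , i′ , j′)) (i≢i′ ∘ cong (proj₁ ∘ proj₂))

δ-≢-col : ∀ β i j i′ j′ → j ≢ j′ → δ (β , i , j) (β , i′ , j′) ≡ + 0
δ-≢-col β i j i′ j′ j≢j′ = 𝟙-no ((β , i , j) ≟T (β , i′ , j′)) (j≢j′ ∘ cong (proj₂ ∘ proj₂))

Σ-sides-sameUp : ∀ r j k → Σ (sides (suc r) j) (sameUp (suc r , j , k)) ≡ + 1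
Σ-sides-sameUp r j 0F =
  cong₂ _+_ (δ-refl (true , suc r , j)) (cong₂ _+_ (δ-≢-col true (suc r) j (suc r) (suc j) (ℕ.1+n≢n ∘ sym))
                                  (cong (_+ + 0) (δ-≢-row true (suc r) j r j ℕ.1+n≢n)))
Σ-sides-sameUp r j (sucF 0F) =
  cong₂ _+_ (δ-≢-col true (suc r) (suc j) (suc r) j ℕ.1+n≢n)
            (cong₂ _+_ (δ-refl (true , suc r , suc j)) (cong (_+ + 0) (δ-≢-row true (suc r) (suc j) r j ℕ.1+n≢n)))
Σ-sides-sameUp r j (sucF (sucF 0F)) =
  cong₂ _+_ (δ-≢-row true r j (suc r) j (ℕ.1+n≢n ∘ sym))
            (cong₂ _+_ (δ-≢-row true r j (suc r) (suc j) (ℕ.1+n≢n ∘ sym)) (cong (_+ + 0) (δ-refl (true , r , j))))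

-- g summed over the up-degrees of the three sides of the downward triangle (r + 1, j), where
-- a = [0 < j] and b = [j < r] say whether it has left and right neighbours in its row and
-- w = [r + 1 < N] whether a row lies below it.
sidesWeight : (ℤ → ℤ) → ℤ → ℤ → ℤ → ℤ
sidesWeight g w a b = g (+ 1 + a + w) + (g (b + + 1 + w) + (g (b + a + + 1) + + 0))

rowWeight : (ℤ → ℤ → ℤ) → ℕ → ℤ
rowWeight F zero    = F (+ 0) (+ 0)
rowWeight F (suc r) = F (+ 0) (+ 1) + F (+ 1) (+ 0) + + r * F (+ 1) (+ 1)

Σ<-row : ∀ (F : ℤ → ℤ → ℤ) r → Σ< (suc r) (λ j → F 𝟙[ 0 ℕ.<? j ] 𝟙[ j ℕ.<? r ]) ≡ rowWeight F r
Σ<-row F zero    = ℤ.+-identityˡ _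
Σ<-row F (suc r) = begin
  Σ< (suc r) ψ + ψ (suc r)
    ≡⟨ cong₂ _+_ (Σ<-shift r ψ) (cong (F (+ 1)) (𝟙-no (suc r ℕ.<? suc r) (ℕ.n≮n (suc r)))) ⟩
  ψ 0 + Σ< r (ψ ∘ suc) + F (+ 1) (+ 0)
    ≡⟨ cong (λ t → ψ 0 + t + F (+ 1) (+ 0))
            (trans (Σ<-cong< r (λ {j} j<r → cong (F (+ 1)) (𝟙-yes (suc j ℕ.<? suc r) (s≤s j<r))))
                   (Σ<-const r (F (+ 1) (+ 1)))) ⟩
  F (+ 0) (+ 1) + + r * F (+ 1) (+ 1) + F (+ 1) (+ 0)
    ≡⟨ swap (F (+ 0) (+ 1)) (+ r * F (+ 1) (+ 1)) (F (+ 1) (+ 0)) ⟩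
  rowWeight F (suc r) ∎
  where
  open ≡-Reasoning
  ψ : ℕ → ℤ
  ψ j = F 𝟙[ 0 ℕ.<? j ] 𝟙[ j ℕ.<? suc r ]
  swap : ∀ a b c → a + b + c ≡ a + c + b
  swap = solve-∀

-- For n = m + 2, exactly 3, 6m and 3·C(m, 2) inner edges have up-degree 1, 2 and 3; profile
-- is twice the corresponding weighted count.
profile : ℤ → (ℤ → ℤ) → ℤ
profile m f = + 6 * f (+ 1) + + 12 * m * f (+ 2) + + 3 * m * (m - + 1) * f (+ 3)

twice-Σ-rows : ∀ (g : ℤ → ℤ) m →
               + 2 * Σ< (suc m) (λ r → rowWeight (sidesWeight g 𝟙[ r ℕ.<? m ]) r)
               ≡ profile (+ m) g
twice-Σ-rows g zero    = base (g (+ 1)) (g (+ 2)) (g (+ 3))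
  where base : ∀ g₁ g₂ g₃ → + 2 * (+ 0 + (g₁ + (g₁ + (g₁ + + 0))))
                            ≡ + 6 * g₁ + + 12 * + 0 * g₂ + + 3 * + 0 * (+ 0 - + 1) * g₃
        base = solve-∀
twice-Σ-rows g (suc m) = begin
  + 2 * (Σ< (suc m) ρ + ρ (suc m))
    ≡⟨ cong (+ 2 *_) (cong₂ _+_
         (Σ<-cong< (suc m) (λ {r} r<m → cong (λ w → rowWeight (sidesWeight g w) r) (𝟙-yes (r ℕ.<? suc m) r<m)))
         (cong (λ w → rowWeight (sidesWeight g w) (suc m)) (𝟙-no (suc m ℕ.<? suc m) (ℕ.n≮n (suc m))))) ⟩
  + 2 * (Σ< (suc m) (rowWeight inner) + rowWeight outer (suc m))
    ≡⟨ cong (λ t → + 2 * (t + rowWeight outer (suc m))) (Σ<-shift m (rowWeight inner)) ⟩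
  + 2 * (rowWeight inner 0 + Σ< m (rowWeight inner ∘ suc) + rowWeight outer (suc m))
    ≡⟨ distribute (rowWeight inner 0) (Σ< m (rowWeight inner ∘ suc)) (rowWeight outer (suc m)) ⟩
  + 2 * rowWeight inner 0 + + 2 * Σ< m (rowWeight inner ∘ suc) + + 2 * rowWeight outer (suc m)
    ≡⟨ cong (λ t → + 2 * rowWeight inner 0 + t + + 2 * rowWeight outer (suc m))
            (Σ<-arith m (inner (+ 0) (+ 1) + inner (+ 1) (+ 0)) (inner (+ 1) (+ 1))) ⟩
  + 2 * rowWeight inner 0
    + (+ 2 * + m * (inner (+ 0) (+ 1) + inner (+ 1) (+ 0)) + + m * (+ m - + 1) * inner (+ 1) (+ 1))
    + + 2 * rowWeight outer (suc m)
    ≡⟨ collect (g (+ 1)) (g (+ 2)) (g (+ 3)) (+ m) ⟩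
  profile (+ suc m) g ∎
  where
  open ≡-Reasoning
  ρ : ℕ → ℤ
  ρ r = rowWeight (sidesWeight g 𝟙[ r ℕ.<? suc m ]) r
  inner outer : ℤ → ℤ → ℤ
  inner = sidesWeight g (+ 1)
  outer = sidesWeight g (+ 0)
  distribute : ∀ x s y → + 2 * (x + s + y) ≡ + 2 * x + + 2 * s + + 2 * y
  distribute = solve-∀
  collect : ∀ g₁ g₂ g₃ m →
            let X = g₂ + (g₂ + (g₁ + + 0))
                A = g₂ + (g₃ + (g₂ + + 0)) + (g₃ + (g₂ + (g₂ + + 0)))
                B = g₃ + (g₃ + (g₃ + + 0))
                Y = g₁ + (g₂ + (g₂ + + 0)) + (g₂ + (g₁ + (g₂ + + 0))) + m * (g₂ + (g₂ + (g₃ + + 0)))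
            in + 2 * X + (+ 2 * m * A + m * (m - + 1) * B) + + 2 * Y
               ≡ + 6 * g₁ + + 12 * (+ 1 + m) * g₂ + + 3 * (+ 1 + m) * (+ 1 + m - + 1) * g₃
  collect = solve-∀

module Triangle (n : ℕ) where

  open Incidence (innerEdges n)

  N : ℕ
  N = n ∸ 1

  downDegree-inner : ∀ r j k → r < N → j ≤ r → downDegree (suc r , j , k) ≡ + 3
  downDegree-inner r₀ j₀ k r₀<N j₀≤r₀ = begin
    Σ (innerEdges n) (sameDown x)
      ≡⟨ Σ-innerEdges n (sameDown x) ⟩
    Σ△ N (λ r j → Σ (sides (suc r) j) (sameDown x))
      ≡⟨ Σ△-cong N (λ r j → trans (cong (λ t → t + (t + (t + + 0))) (δ-coords false (suc r₀) j₀ (suc r) j))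
                                  (thrice 𝟙[ r₀ ℕ.≟ r ] 𝟙[ j₀ ℕ.≟ j ])) ⟩
    Σ△ N (λ r j → 𝟙[ r₀ ℕ.≟ r ] * (𝟙[ j₀ ℕ.≟ j ] * + 3))
      ≡⟨ Σ△-δ N r₀ j₀ (λ _ _ → + 3) ⟩
    𝟙[ r₀ ℕ.<? N ] * (𝟙[ j₀ ℕ.<? suc r₀ ] * + 3)
      ≡⟨ cong₂ (λ u v → u * (v * + 3))
               (𝟙-yes (r₀ ℕ.<? N) r₀<N) (𝟙-yes (j₀ ℕ.<? suc r₀) (s≤s j₀≤r₀)) ⟩
    + 3 ∎
    where
    open ≡-Reasoning
    x = (suc r₀ , j₀ , k)
    thrice : ∀ a b → a * b + (a * b + (a * b + + 0)) ≡ a * (b * + 3)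
    thrice = solve-∀

  multiplicity-inner : ∀ r j k → r < N → j ≤ r → multiplicity (suc r , j , k) ≡ + 1
  multiplicity-inner r₀ j₀ k r₀<N j₀≤r₀ = begin
    Σ (innerEdges n) (λ z → sameDown x z * sameUp x z)
      ≡⟨ Σ-innerEdges n (λ z → sameDown x z * sameUp x z) ⟩
    Σ△ N (λ r j → Σ (sides (suc r) j) (λ z → sameDown x z * sameUp x z))
      ≡⟨ Σ△-cong N (λ r j → trans (cong (λ t → t * sameUp x (suc r , j , 0F) + (t * sameUp x (suc r , j , sucF 0F)
                                                      + (t * sameUp x (suc r , j , sucF (sucF 0F)) + + 0)))
                                        (δ-coords false (suc r₀) j₀ (suc r) j))
                                  (factor 𝟙[ r₀ ℕ.≟ r ] 𝟙[ j₀ ℕ.≟ j ] _ _ _)) ⟩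
    Σ△ N (λ r j → 𝟙[ r₀ ℕ.≟ r ] * (𝟙[ j₀ ℕ.≟ j ] * Σ (sides (suc r) j) (sameUp x)))
      ≡⟨ Σ△-δ N r₀ j₀ (λ r j → Σ (sides (suc r) j) (sameUp x)) ⟩
    𝟙[ r₀ ℕ.<? N ] * (𝟙[ j₀ ℕ.<? suc r₀ ] * Σ (sides (suc r₀) j₀) (sameUp x))
      ≡⟨ cong₂ (λ u v → u * (v * Σ (sides (suc r₀) j₀) (sameUp x)))
               (𝟙-yes (r₀ ℕ.<? N) r₀<N) (𝟙-yes (j₀ ℕ.<? suc r₀) (s≤s j₀≤r₀)) ⟩
    + 1 * (+ 1 * Σ (sides (suc r₀) j₀) (sameUp x))
      ≡⟨ trans (ℤ.*-identityˡ _) (trans (ℤ.*-identityˡ _) (Σ-sides-sameUp r₀ j₀ k)) ⟩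
    + 1 ∎
    where
    open ≡-Reasoning
    x = (suc r₀ , j₀ , k)
    factor : ∀ a b u₀ u₁ u₂ → a * b * u₀ + (a * b * u₁ + (a * b * u₂ + + 0))
                              ≡ a * (b * (u₀ + (u₁ + (u₂ + + 0))))
    factor = solve-∀

  Σ△-left : ∀ a b → a ≤ N → Σ△ N (λ r j → 𝟙[ a ℕ.≟ suc r ] * 𝟙[ b ℕ.≟ j ]) ≡ 𝟙[ b ℕ.<? a ]
  Σ△-left zero     b _   = Σ△-zero N
  Σ△-left (suc a) b a<N =
    trans (Σ△-δ₁ N a b) (trans (cong (_* 𝟙[ b ℕ.<? suc a ]) (𝟙-yes (a ℕ.<? N) a<N)) (ℤ.*-identityˡ _))

  Σ△-right : ∀ a b → a ≤ N → b ≤ a →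
             Σ△ N (λ r j → 𝟙[ a ℕ.≟ suc r ] * 𝟙[ b ℕ.≟ suc j ]) ≡ 𝟙[ 0 ℕ.<? b ]
  Σ△-right a       zero    _   _         =
    trans (Σ△-cong N (λ r j → ℤ.*-zeroʳ 𝟙[ a ℕ.≟ suc r ])) (Σ△-zero N)
  Σ△-right (suc a) (suc b) a<N (s≤s b≤a) =
    trans (Σ△-δ₁ N a b) (cong₂ _*_ (𝟙-yes (a ℕ.<? N) a<N) (𝟙-yes (b ℕ.<? suc a) (s≤s b≤a)))

  Σ△-top : ∀ a b → b ≤ a → Σ△ N (λ r j → 𝟙[ a ℕ.≟ r ] * 𝟙[ b ℕ.≟ j ]) ≡ 𝟙[ a ℕ.<? N ]
  Σ△-top a b b≤a =
    trans (Σ△-δ₁ N a b)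
          (trans (cong (𝟙[ a ℕ.<? N ] *_) (𝟙-yes (b ℕ.<? suc a) (s≤s b≤a))) (ℤ.*-identityʳ _))

  Σ-sameUp-at : ∀ a b → a ≤ N → b ≤ a →
                Σ (innerEdges n) (λ y → δ (true , a , b) (upSide y))
                ≡ 𝟙[ b ℕ.<? a ] + 𝟙[ 0 ℕ.<? b ] + 𝟙[ a ℕ.<? N ]
  Σ-sameUp-at a b a≤N b≤a = begin
    Σ (innerEdges n) (λ y → δ (true , a , b) (upSide y))
      ≡⟨ Σ-innerEdges n (λ y → δ (true , a , b) (upSide y)) ⟩
    Σ△ N (λ r j → Σ (sides (suc r) j) (λ y → δ (true , a , b) (upSide y)))
      ≡⟨ Σ△-cong N (λ r j → trans (cong₂ _+_ (δ-coords true a b (suc r) j)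
                                             (cong₂ _+_ (δ-coords true a b (suc r) (suc j))
                                                        (cong (_+ + 0) (δ-coords true a b r j))))
                                  (flatten (𝟙[ a ℕ.≟ suc r ] * 𝟙[ b ℕ.≟ j ])
                                           (𝟙[ a ℕ.≟ suc r ] * 𝟙[ b ℕ.≟ suc j ])
                                           (𝟙[ a ℕ.≟ r ] * 𝟙[ b ℕ.≟ j ]))) ⟩
    Σ△ N (λ r j → 𝟙[ a ℕ.≟ suc r ] * 𝟙[ b ℕ.≟ j ] + 𝟙[ a ℕ.≟ suc r ] * 𝟙[ b ℕ.≟ suc j ]
                  + 𝟙[ a ℕ.≟ r ] * 𝟙[ b ℕ.≟ j ])
      ≡⟨ trans (Σ△-+ N _ _) (cong (_+ Σ△ N (λ r j → 𝟙[ a ℕ.≟ r ] * 𝟙[ b ℕ.≟ j ])) (Σ△-+ N _ _)) ⟩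
    Σ△ N (λ r j → 𝟙[ a ℕ.≟ suc r ] * 𝟙[ b ℕ.≟ j ])
      + Σ△ N (λ r j → 𝟙[ a ℕ.≟ suc r ] * 𝟙[ b ℕ.≟ suc j ])
      + Σ△ N (λ r j → 𝟙[ a ℕ.≟ r ] * 𝟙[ b ℕ.≟ j ])
      ≡⟨ cong₂ _+_ (cong₂ _+_ (Σ△-left a b a≤N) (Σ△-right a b a≤N b≤a)) (Σ△-top a b b≤a) ⟩
    𝟙[ b ℕ.<? a ] + 𝟙[ 0 ℕ.<? b ] + 𝟙[ a ℕ.<? N ] ∎
    where
    open ≡-Reasoning
    flatten : ∀ x y z → x + (y + (z + + 0)) ≡ x + y + z
    flatten = solve-∀

  Σ-sides-upDegree : ∀ (g : ℤ → ℤ) r j → r < N → j ≤ r →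
                     Σ (sides (suc r) j) (g ∘ upDegree)
                     ≡ sidesWeight g 𝟙[ suc r ℕ.<? N ] 𝟙[ 0 ℕ.<? j ] 𝟙[ j ℕ.<? r ]
  Σ-sides-upDegree g r j r<N j≤r =
    cong₂ _+_ (cong g left) (cong₂ _+_ (cong g right) (cong (λ t → g t + + 0) top))
    where
    left : upDegree (suc r , j , 0F) ≡ + 1 + 𝟙[ 0 ℕ.<? j ] + 𝟙[ suc r ℕ.<? N ]
    left = trans (Σ-sameUp-at (suc r) j r<N (ℕ.m≤n⇒m≤1+n j≤r))
                 (cong (λ t → t + 𝟙[ 0 ℕ.<? j ] + 𝟙[ suc r ℕ.<? N ]) (𝟙-yes (j ℕ.<? suc r) (s≤s j≤r)))
    right : upDegree (suc r , j , sucF 0F) ≡ 𝟙[ j ℕ.<? r ] + + 1 + 𝟙[ suc r ℕ.<? N ]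
    right = Σ-sameUp-at (suc r) (suc j) r<N (s≤s j≤r)
    top : upDegree (suc r , j , sucF (sucF 0F)) ≡ 𝟙[ j ℕ.<? r ] + 𝟙[ 0 ℕ.<? j ] + + 1
    top = trans (Σ-sameUp-at r j (ℕ.<⇒≤ r<N) j≤r)
                (cong (_+_ (𝟙[ j ℕ.<? r ] + 𝟙[ 0 ℕ.<? j ])) (𝟙-yes (r ℕ.<? N) r<N))

module _ (m : ℕ) where

  open Incidence (innerEdges (suc (suc m)))
  open Triangle (suc (suc m))

  twice-Σ-upDegree : ∀ (g : ℤ → ℤ) →
                     + 2 * Σ (innerEdges (suc (suc m))) (g ∘ upDegree)
                     ≡ profile (+ m) g
  twice-Σ-upDegree g = begin
    + 2 * Σ (innerEdges (suc (suc m))) (g ∘ upDegree)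
      ≡⟨ cong (+ 2 *_) (Σ-innerEdges (suc (suc m)) (g ∘ upDegree)) ⟩
    + 2 * Σ△ (suc m) (λ r j → Σ (sides (suc r) j) (g ∘ upDegree))
      ≡⟨ cong (+ 2 *_) (Σ△-cong< (suc m) (λ {r} {j} → Σ-sides-upDegree g r j)) ⟩
    + 2 * Σ△ (suc m) (λ r j → sidesWeight g 𝟙[ r ℕ.<? m ] 𝟙[ 0 ℕ.<? j ] 𝟙[ j ℕ.<? r ])
      ≡⟨ cong (+ 2 *_) (Σ<-cong (suc m) (λ r → Σ<-row (sidesWeight g 𝟙[ r ℕ.<? m ]) r)) ⟩
    + 2 * Σ< (suc m) (λ r → rowWeight (sidesWeight g 𝟙[ r ℕ.<? m ]) r)
      ≡⟨ twice-Σ-rows g m ⟩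
    profile (+ m) g ∎
    where open ≡-Reasoning

module _ (n : ℕ) where

  open Incidence (innerEdges n)
  open Triangle n

  private
    compat₃-sym₁₂ : ∀ x y z → pairwise₃ compatible? x y z ≡ pairwise₃ compatible? y x z
    compat₃-sym₁₂ x y z = trans (cong (λ t → t * compat x z * compat y z) (compat-sym x y))
                                (swap (compat y x) (compat x z) (compat y z))
      where swap : ∀ a b c → a * b * c ≡ a * c * b
            swap = solve-∀

    compat₃-sym₂₃ : ∀ x y z → pairwise₃ compatible? x y z ≡ pairwise₃ compatible? x z y
    compat₃-sym₂₃ x y z = trans (cong (compat x y * compat x z *_) (compat-sym y z))
                                (swap (compat x y) (compat x z) (compat z y))
      where swap : ∀ a b c → a * b * c ≡ b * a * c
            swap = solve-∀

    compat₃-diag : ∀ x z → pairwise₃ compatible? x x z ≡ + 0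
    compat₃-diag x z = cong (λ t → t * compat x z * compat x z) (compat-irrefl x)

  sixfold-L₃ : + 6 * + L n 3 ≡ Σ (innerEdges n) (λ x → Φ E (+ 3) (upDegree x))
  sixfold-L₃ = begin
    + 6 * + L n 3
      ≡⟨ cong (+ 6 *_) (#pairwise-sublists₃ compatible? (innerEdges n)) ⟩
    + 6 * Σ₃ (innerEdges n) (pairwise₃ compatible?)
      ≡˘⟨ Σ-ordered-triples (pairwise₃ compatible?) compat₃-sym₁₂ compat₃-sym₂₃ compat₃-diag
                            (innerEdges n) ⟩
    Σ (innerEdges n) (λ x → Σ (innerEdges n) (λ y → Σ (innerEdges n) (pairwise₃ compatible? x y)))
      ≡⟨ Σ-compat-triples (All-innerEdges n {λ x → multiplicity x ≡ + 1} multiplicity-inner) ⟩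
    Σ (innerEdges n) (λ x → Φ E (downDegree x) (upDegree x))
      ≡⟨ Σ-cong-All (All-innerEdges n {λ x → downDegree x ≡ + 3} downDegree-inner)
                    (λ {x} → cong (λ p → Φ E p (upDegree x))) ⟩
    Σ (innerEdges n) (λ x → Φ E (+ 3) (upDegree x)) ∎
    where open ≡-Reasoning

-- The closed form

ψ : ℤ → ℤ → ℤ
ψ e Q = e * e - + 12 * e + + 16 + (+ 48 - + 6 * e) * Q + + 8 * Q * Q

-- The ring solver does not unfold definitions, so Φ, ψ, profile and _^_ are written out in
-- the identities below.
four-Φ : ∀ E Q → + 4 * Φ E (+ 3) Q ≡ ψ (+ 2 * E) Q
four-Φ = expanded
  where
  expanded : ∀ E Q → + 4 * ((E + + 2 - + 2 * + 3 - + 2 * Q) * (E + + 1 - + 3 - Q) + + 2 * (+ 3 - + 1) * (Q - + 1))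
                     ≡ (+ 2 * E) * (+ 2 * E) - + 12 * (+ 2 * E) + + 16 + (+ 48 - + 6 * (+ 2 * E)) * Q + + 8 * Q * Q
  expanded = solve-∀

profile-*ˡ : ∀ m k f → k * profile m f ≡ profile m (λ Q → k * f Q)
profile-*ˡ m k f = expanded m k (f (+ 1)) (f (+ 2)) (f (+ 3))
  where
  expanded : ∀ m k a b c → k * (+ 6 * a + + 12 * m * b + + 3 * m * (m - + 1) * c)
                           ≡ + 6 * (k * a) + + 12 * m * (k * b) + + 3 * m * (m - + 1) * (k * c)
  expanded = solve-∀

profile-cong : ∀ m {f g : ℤ → ℤ} → (∀ Q → f Q ≡ g Q) → profile m f ≡ profile m g
profile-cong m eq = cong₂ _+_ (cong₂ _+_ (cong (+ 6 *_) (eq (+ 1))) (cong (+ 12 * m *_) (eq (+ 2))))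
                              (cong (+ 3 * m * (m - + 1) *_) (eq (+ 3)))

closed-form : ∀ m → profile m (ψ (profile m (λ _ → + 1)))
              ≡ + 3 * ((+ 2 + m - + 2) * (+ 9 * (+ 2 + m) ^ 5 - + 9 * (+ 2 + m) ^ 4 - + 81 * (+ 2 + m) ^ 3
                                          + + 81 * (+ 2 + m) ^ 2 + + 160 * (+ 2 + m) - + 192))
closed-form = expanded
  where
  expanded : ∀ m → let e  = + 6 * + 1 + + 12 * m * + 1 + + 3 * m * (m - + 1) * + 1
                       f  = λ Q → e * e - + 12 * e + + 16 + (+ 48 - + 6 * e) * Q + + 8 * Q * Q
                       n  = + 2 + m
                       n² = n * (n * + 1)
                       n³ = n * n²
                       n⁴ = n * n³
                       n⁵ = n * n⁴
                   in + 6 * f (+ 1) + + 12 * m * f (+ 2) + + 3 * m * (m - + 1) * f (+ 3)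
                      ≡ + 3 * ((n - + 2) * (+ 9 * n⁵ - + 9 * n⁴ - + 81 * n³ + + 81 * n² + + 160 * n - + 192))
  expanded = solve-∀

mainTheorem3 : (n : ℕ) → n ≥ 2 →
    + 16 * + L n 3 ≡ (+ n - + 2) * (+ 9 * (+ n) ^ 5 - + 9 * (+ n) ^ 4 - + 81 * (+ n) ^ 3 + + 81 * (+ n) ^ 2 + + 160 * + n - + 192)
mainTheorem3 (suc (suc m)) _ = ℤ.*-cancelˡ-≡ (+ 3) _ _ (begin
  + 3 * (+ 16 * + L n 3)                              ≡⟨ rescale (+ L n 3) ⟩
  + 4 * (+ 2 * (+ 6 * + L n 3))                       ≡⟨ cong (λ t → + 4 * (+ 2 * t)) (sixfold-L₃ n) ⟩
  + 4 * (+ 2 * Σ (innerEdges n) (Φ E (+ 3) ∘ upDegree)) ≡⟨ cong (+ 4 *_) (twice-Σ-upDegree m (Φ E (+ 3))) ⟩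
  + 4 * profile (+ m) (Φ E (+ 3))                     ≡⟨ profile-*ˡ (+ m) (+ 4) (Φ E (+ 3)) ⟩
  profile (+ m) (λ Q → + 4 * Φ E (+ 3) Q)             ≡⟨ profile-cong (+ m) (four-Φ E) ⟩
  profile (+ m) (ψ (+ 2 * E))                         ≡⟨ cong (profile (+ m) ∘ ψ) twice-E ⟩
  profile (+ m) (ψ (profile (+ m) (λ _ → + 1)))       ≡⟨ closed-form (+ m) ⟩
  + 3 * ((+ n - + 2) * (+ 9 * (+ n) ^ 5 - + 9 * (+ n) ^ 4 - + 81 * (+ n) ^ 3 + + 81 * (+ n) ^ 2 + + 160 * + n - + 192)) ∎)
  where
  open ≡-Reasoning
  n = suc (suc m)
  open Incidence (innerEdges n)
  twice-E : + 2 * E ≡ profile (+ m) (λ _ → + 1)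
  twice-E = trans (cong (+ 2 *_) (sym (Σ-one (innerEdges n)))) (twice-Σ-upDegree m (λ _ → + 1))
  rescale : ∀ l → + 3 * (+ 16 * l) ≡ + 4 * (+ 2 * (+ 6 * l))
  rescale = solve-∀
mainTheorem3 (suc zero) (s≤s ())
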